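{- (i) Suppose there is a function $f:\prod_{X:\mathcal{U}} X\to X$ which is natural under equivalence and such that $\neg\prod_{x:\mathbf{2}} f_{\mathbf{2}}(x)=x$. Then the law of excluded middle holds. (ii) Assuming function extensionality, conversely, if the law of excluded middle holds then there exists a function $f:\prod_{X:\mathcal{U}} X\to X$ which is natural under equivalence and satisfies $\neg\prod_{x:\mathbf{2}} f_{\mathbf{2}}(x)=x$.
   Context: Work in intensional Martin-Löf type theory with $\Pi$-, $\Sigma$-, identity, finite types ($\mathbf{0},\mathbf{1},\mathbf{2}$) and natural numbers, and a universe $\mathcal{U}$ closed under these. $a=b$ denotes the identity type, $\neg A$ means $A\to\mathbf{0}$, and $f_X$ abbreviates $f(X)$. A type $P$ is a proposition if any two of its elements are equal. The law of excluded middle is: for every $P:\mathcal{U}$ that is a proposition, $P+\neg P$. An equivalence $e:X\to Y$ is a map with a left inverse and a right inverse. A function $f:\prod_{X:\mathcal{U}}X\to X$ is natural under equivalence if for all $X,Y:\mathcal{U}$, every equivalence $e:X\to Y$ and every $x:X$ we have $e(f_X(x))=f_Y(e(x))$. -}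

module Defs where

open import Level using (Level)
open import Data.Product using (Σ; _×_; _,_)
open import Data.Sum using (_⊎_)
open import Data.Bool using (Bool)
open import Relation.Nullary using (¬_)
open import Relation.Binary.PropositionalEquality using (_≡_)

-- The universe 𝒰 is Set (= Set₀); 𝟐 is Bool.

isProp : Set → Set
isProp P = (x y : P) → x ≡ y

LEM : Set₁
LEM = (P : Set) → isProp P → P ⊎ ¬ P

isEquiv : {X Y : Set} → (X → Y) → Set
isEquiv {X} {Y} e =
  (Σ (Y → X) λ g → (x : X) → g (e x) ≡ x) ×
  (Σ (Y → X) λ h → (y : Y) → e (h y) ≡ y)

NaturalUnderEquiv : ((X : Set) → X → X) → Set₁
NaturalUnderEquiv f =
  (X Y : Set) (e : X → Y) → isEquiv e → (x : X) → e (f X x) ≡ f Y (e x)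

-- (i) Naturality forces f to commute with negation on 𝟐, so f₂ = not. Given a
-- proposition P, look at f at inl ⋆ in 𝟏 + P: if it lands in P we have P; if it
-- stays at inl ⋆ then any p : P makes 𝟏 + P ≃ 𝟐 with inl ⋆ ↦ true, and
-- naturality would give f₂ true = true, so ¬ P.
-- (ii) With excluded middle, decide whether x has exactly one other element
-- (a proposition under funext) and let f swap x with it, fixing x otherwise.
-- Having exactly one other element is invariant under equivalence, so f is
-- natural, and on 𝟐 it is not.
module Submission where

open import Defs
open import Level using (0ℓ; suc)
open import Data.Product using (Σ; _×_; _,_; proj₁; proj₂)
open import Data.Bool using (Bool; true; false; not)
open import Data.Bool.Properties using (not-involutive)
open import Data.Unit using (⊤; tt)
open import Data.Empty using (⊥-elim)
open import Data.Sum using (_⊎_; inj₁; inj₂)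
open import Relation.Nullary using (¬_)
open import Relation.Binary.PropositionalEquality
  using (_≡_; _≢_; refl; sym; trans; cong; subst; module ≡-Reasoning)
open import Axiom.Extensionality.Propositional using (Extensionality)
open import Axiom.UniquenessOfIdentityProofs using (UIP; module Constant⇒UIP)

private
  variable
    A X Y : Set

Inverse : (X → Y) → Set
Inverse {X} {Y} e = Σ (Y → X) λ g → ((x : X) → g (e x) ≡ x) × ((y : Y) → e (g y) ≡ y)

inverse⇒isEquiv : {e : X → Y} → Inverse e → isEquiv e
inverse⇒isEquiv (g , ge , eg) = (g , ge) , (g , eg)

isEquiv⇒inverse : {e : X → Y} → isEquiv e → Inverse e
isEquiv⇒inverse {Y = Y} {e = e} ((g , ge) , (h , eh)) = g , ge , eg
  where
  open ≡-Reasoning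
  eg : (y : Y) → e (g y) ≡ y
  eg y = begin
    e (g y)         ≡⟨ cong (λ z → e (g z)) (eh y) ⟨
    e (g (e (h y))) ≡⟨ cong e (ge (h y)) ⟩
    e (h y)         ≡⟨ eh y ⟩
    y               ∎

not-isEquiv : isEquiv not
not-isEquiv = inverse⇒isEquiv (not , not-involutive , not-involutive)

module _ (f : (X : Set) → X → X) (natural : NaturalUnderEquiv f) where

  natural-Bool-false : f Bool false ≡ not (f Bool true)
  natural-Bool-false = sym (natural Bool Bool not not-isEquiv true)

  natural-nonId⇒Bool-true : ¬ ((b : Bool) → f Bool b ≡ b) → f Bool true ≡ false
  natural-nonId⇒Bool-true nonId with f Bool true in fT
  ... | false = refl
  ... | true  = ⊥-elim (nonId λ { true → fT ; false → trans natural-Bool-false (cong not fT) })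

  module _ (P : Set) (P-prop : isProp P) where

    ⊤⊎P→Bool : ⊤ ⊎ P → Bool
    ⊤⊎P→Bool (inj₁ _) = true
    ⊤⊎P→Bool (inj₂ _) = false

    ⊤⊎P→Bool-inverse : P → Inverse ⊤⊎P→Bool
    ⊤⊎P→Bool-inverse p = Bool→⊤⊎P , left , λ { true → refl ; false → refl }
      where
      Bool→⊤⊎P : Bool → ⊤ ⊎ P
      Bool→⊤⊎P true  = inj₁ tt
      Bool→⊤⊎P false = inj₂ p
      left : (u : ⊤ ⊎ P) → Bool→⊤⊎P (⊤⊎P→Bool u) ≡ u
      left (inj₁ tt) = refl
      left (inj₂ q)  = cong inj₂ (P-prop p q)

    natural-nonId⇒decide : ¬ ((b : Bool) → f Bool b ≡ b) → P ⊎ ¬ P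
    natural-nonId⇒decide nonId with f (⊤ ⊎ P) (inj₁ tt) in fInl
    ... | inj₂ p  = inj₁ p
    ... | inj₁ tt = inj₂ λ p → true≢false (begin
      true                          ≡⟨ cong ⊤⊎P→Bool fInl ⟨
      ⊤⊎P→Bool (f (⊤ ⊎ P) (inj₁ tt)) ≡⟨ natural (⊤ ⊎ P) Bool ⊤⊎P→Bool
                                          (inverse⇒isEquiv (⊤⊎P→Bool-inverse p)) (inj₁ tt) ⟩
      f Bool true                   ≡⟨ natural-nonId⇒Bool-true nonId ⟩
      false                         ∎)
      where
      open ≡-Reasoning
      true≢false : true ≢ false
      true≢false ()

natural-nonId⇒LEM : (f : (X : Set) → X → X) → NaturalUnderEquiv f →
                    ¬ ((b : Bool) → f Bool b ≡ b) → LEM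
natural-nonId⇒LEM f natural nonId P P-prop = natural-nonId⇒decide f natural P P-prop nonId

isContr : Set → Set
isContr A = Σ A λ c → (a : A) → c ≡ a

isContr⇒isProp : isContr A → isProp A
isContr⇒isProp (c , h) a a′ = trans (sym (h a)) (h a′)

isProp⇒UIP : isProp A → UIP A
isProp⇒UIP {A} A-prop = Constant⇒UIP.≡-irrelevant canonical (λ _ _ → refl)
  where
  canonical : {x y : A} → x ≡ y → x ≡ y
  canonical {x} {y} _ = trans (sym (A-prop x x)) (A-prop x y)

retract-isContr : {B : Set} (r : A → B) (s : B → A) → ((b : B) → r (s b) ≡ b) →
                  isContr A → isContr B
retract-isContr r s rs (c , h) = r c , λ b → trans (cong r (h (s b))) (rs b)

Σ-≡-proj₁ : {B : A → Set} → ((a : A) → isProp (B a)) →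
            {u v : Σ A B} → proj₁ u ≡ proj₁ v → u ≡ v
Σ-≡-proj₁ B-prop {a , b} {.a , b′} refl = cong (a ,_) (B-prop a b b′)

UniqueOther : (X : Set) → X → Set
UniqueOther X x = isContr (Σ X (_≢ x))

module _ (fe : Extensionality 0ℓ 0ℓ) where

  ¬-isProp : isProp (¬ A)
  ¬-isProp u v = fe λ a → ⊥-elim (u a)

  isContr-isProp : isProp (isContr A)
  isContr-isProp (c , h) (c′ , h′) with h c′
  ... | refl = cong (c ,_) (fe λ a → isProp⇒UIP (isContr⇒isProp (c , h)) (h a) (h′ a))

  UniqueOther-transport : {e : X → Y} → Inverse e → (x : X) →
                          UniqueOther X x → UniqueOther Y (e x)
  UniqueOther-transport {X} {Y} {e} (g , ge , eg) x = retract-isContr to from to∘from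
    where
    to : Σ X (_≢ x) → Σ Y (_≢ e x)
    to (x′ , x′≢x) = e x′ , λ ex′≡ex → x′≢x (trans (sym (ge x′)) (trans (cong g ex′≡ex) (ge x)))
    from : Σ Y (_≢ e x) → Σ X (_≢ x)
    from (y , y≢ex) = g y , λ gy≡x → y≢ex (trans (sym (eg y)) (cong e gy≡x))
    to∘from : (u : Σ Y (_≢ e x)) → to (from u) ≡ u
    to∘from (y , _) = Σ-≡-proj₁ (λ _ → ¬-isProp) (eg y)

  Bool-UniqueOther-true : UniqueOther Bool true
  Bool-UniqueOther-true = (false , λ ()) , λ
    { (false , _)   → Σ-≡-proj₁ (λ _ → ¬-isProp) refl
    ; (true , t≢t) → ⊥-elim (t≢t refl)
    }

  module _ (lem : LEM) where

    swapWithUniqueOther-by : (X : Set) (x : X) → UniqueOther X x ⊎ ¬ UniqueOther X x → X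
    swapWithUniqueOther-by X x (inj₁ ((y , _) , _)) = y
    swapWithUniqueOther-by X x (inj₂ _)             = x

    decideUniqueOther : (X : Set) (x : X) → UniqueOther X x ⊎ ¬ UniqueOther X x
    decideUniqueOther X x = lem (UniqueOther X x) isContr-isProp

    swapWithUniqueOther : (X : Set) → X → X
    swapWithUniqueOther X x = swapWithUniqueOther-by X x (decideUniqueOther X x)

    swapWithUniqueOther-commutes : {e : X → Y} → Inverse e → (x : X) →
                                   e (swapWithUniqueOther X x) ≡ swapWithUniqueOther Y (e x)
    swapWithUniqueOther-commutes {X} {Y} {e} e⁻¹@(_ , ge , eg) x =
      by-cases (decideUniqueOther X x) (decideUniqueOther Y (e x))
      where
      by-cases : (dX : UniqueOther X x ⊎ ¬ UniqueOther X x)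
                 (dY : UniqueOther Y (e x) ⊎ ¬ UniqueOther Y (e x)) →
                 e (swapWithUniqueOther-by X x dX) ≡ swapWithUniqueOther-by Y (e x) dY
      by-cases (inj₁ uX) (inj₁ (_ , contract)) =
        sym (cong proj₁ (contract (proj₁ (UniqueOther-transport e⁻¹ x uX))))
      by-cases (inj₁ uX) (inj₂ ¬uY) = ⊥-elim (¬uY (UniqueOther-transport e⁻¹ x uX))
      by-cases (inj₂ ¬uX) (inj₁ uY) =
        ⊥-elim (¬uX (subst (UniqueOther X) (ge x) (UniqueOther-transport (e , eg , ge) (e x) uY)))
      by-cases (inj₂ _) (inj₂ _) = refl

    swapWithUniqueOther-natural : NaturalUnderEquiv swapWithUniqueOther
    swapWithUniqueOther-natural X Y e e-equiv =
      swapWithUniqueOther-commutes (isEquiv⇒inverse e-equiv)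

    swapWithUniqueOther-moves : (X : Set) (x : X) → UniqueOther X x → swapWithUniqueOther X x ≢ x
    swapWithUniqueOther-moves X x u = by-moves (decideUniqueOther X x)
      where
      by-moves : (d : UniqueOther X x ⊎ ¬ UniqueOther X x) → swapWithUniqueOther-by X x d ≢ x
      by-moves (inj₁ ((_ , y≢x) , _)) = y≢x
      by-moves (inj₂ ¬u)              = ⊥-elim (¬u u)

    swapWithUniqueOther-nonId : ¬ ((b : Bool) → swapWithUniqueOther Bool b ≡ b)
    swapWithUniqueOther-nonId fixes =
      swapWithUniqueOther-moves Bool true Bool-UniqueOther-true (fixes true)

theorem2p1 : ((f : (X : Set) → X → X)
               → NaturalUnderEquiv f
               → ¬ ((x : Bool) → f Bool x ≡ x)
               → LEM)
             × ((Extensionality 0ℓ 0ℓ × Extensionality 0ℓ (suc 0ℓ)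
                × Extensionality (suc 0ℓ) 0ℓ × Extensionality (suc 0ℓ) (suc 0ℓ))
               → LEM
               → Σ ((X : Set) → X → X) λ f
                   → NaturalUnderEquiv f × ¬ ((x : Bool) → f Bool x ≡ x))
theorem2p1 = natural-nonId⇒LEM
           , λ (fe , _) lem → swapWithUniqueOther fe lem
                            , swapWithUniqueOther-natural fe lem
                            , swapWithUniqueOther-nonId fe lem
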